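{- If $G$ is a $2$-edge connected finite simple graph with order $n$ and maximum degree $\Delta$, then \[ \mathrm{mof}(G) \leq \frac{ (\lceil \frac{\Delta}{2} \rceil -1) n + 1}{ \lceil \frac{\Delta}{2} \rceil}. \]
   Context: An orientation $D$ of a simple graph $G$ assigns to each edge exactly one direction; if $(u,v)$ is an arc, $v$ is an out-neighbor of $u$. Oriented $1$-forcing: starting from a nonempty set $S$ of colored vertices, repeatedly, any colored vertex with at most one non-colored out-neighbor forces that out-neighbor to become colored (all forcings in a step simultaneous), until no change occurs; $S$ is a forcing set if all vertices end up colored. $F(D)$ is the minimum size of a forcing set of $D$, and $\mathrm{mof}(G)$ is the minimum of $F(D)$ over all orientations $D$ of $G$. -}

module Defs where

open import Data.Nat using (ℕ; zero; suc; _+_; _≤_; _⊔_; _≡ᵇ_)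
open import Data.Fin using (Fin)
open import Data.Bool using (Bool; true; false; if_then_else_; _∧_; _∨_; not; _xor_)
open import Data.List using (List; map; foldr; allFin)
open import Data.Nat.ListAction using (sum)
open import Data.Bool.ListAction using (or)
open import Data.Product using (_×_; ∃)
open import Data.Sum using (_⊎_)
open import Relation.Binary.PropositionalEquality using (_≡_)
open import Relation.Nullary using (¬_)

count : {n : ℕ} → (Fin n → Bool) → ℕ
count {n} p = sum (map (λ u → if p u then 1 else 0) (allFin n))

anyV : {n : ℕ} → (Fin n → Bool) → Bool
anyV {n} p = or (map p (allFin n))

record Graph (n : ℕ) : Set where
  field
    adj   : Fin n → Fin n → Bool
    sym   : ∀ u v → adj u v ≡ adj v u
    irrefl : ∀ u → adj u u ≡ false
open Graph public

degree : {n : ℕ} → Graph n → Fin n → ℕ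
degree G v = count (adj G v)

maxDegree : {n : ℕ} → Graph n → ℕ
maxDegree {n} G = foldr _⊔_ 0 (map (degree G) (allFin n))

data Reach {n : ℕ} (E : Fin n → Fin n → Set) : Fin n → Fin n → Set where
  here : ∀ {u} → Reach E u u
  step : ∀ {u v w} → E u v → Reach E v w → Reach E u w

Connected : {n : ℕ} → (Fin n → Fin n → Set) → Set
Connected {n} E = ∀ (u v : Fin n) → Reach E u v

Edge : {n : ℕ} → Graph n → Fin n → Fin n → Set
Edge G u v = adj G u v ≡ true

EdgeMinus : {n : ℕ} → Graph n → Fin n → Fin n → Fin n → Fin n → Set
EdgeMinus G a b u v = Edge G u v × ¬ ((u ≡ a × v ≡ b) ⊎ (u ≡ b × v ≡ a))

TwoEdgeConnected : {n : ℕ} → Graph n → Set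
TwoEdgeConnected {n} G =
  (2 ≤ n) × Connected (Edge G) ×
  (∀ a b → Edge G a b → Connected (EdgeMinus G a b))

record Orientation {n : ℕ} (G : Graph n) : Set where
  field
    arc      : Fin n → Fin n → Bool
    arc⇒adj  : ∀ u v → arc u v ≡ true → adj G u v ≡ true
    oneDir   : ∀ u v → adj G u v ≡ true → (arc u v xor arc v u) ≡ true
open Orientation public

uncoloredOut : {n : ℕ} {G : Graph n} → Orientation G → (Fin n → Bool) → Fin n → ℕ
uncoloredOut D C u = count (λ v → arc D u v ∧ not (C v))

forces : {n : ℕ} {G : Graph n} → Orientation G → (Fin n → Bool) → Fin n → Fin n → Bool
forces D C u v = C u ∧ arc D u v ∧ not (C v) ∧ (uncoloredOut D C u ≡ᵇ 1)

forceStep : {n : ℕ} {G : Graph n} → Orientation G → (Fin n → Bool) → (Fin n → Bool)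
forceStep D C v = C v ∨ anyV (λ u → forces D C u v)

iterate : {A : Set} → (A → A) → ℕ → A → A
iterate f zero    x = x
iterate f (suc k) x = f (iterate f k x)

IsForcingSet : {n : ℕ} {G : Graph n} → Orientation G → (Fin n → Bool) → Set
IsForcingSet {n} D S =
  (1 ≤ count S) × ∃ λ k → ∀ (v : Fin n) → iterate (forceStep D) k S v ≡ true

-- mof(G) ≤ m  (unfolding mof = min over orientations D of F(D),
-- F(D) = min size of a forcing set of D)
MofAtMost : {n : ℕ} → Graph n → ℕ → Set
MofAtMost G m = ∃ λ (D : Orientation G) → ∃ λ S → IsForcingSet D S × count S ≤ m

module Submission where

-- Let c = ⌈Δ/2⌉ and fix a breadth-first spanning tree.
-- Since Δ ≤ 2c, the children of a vertex can be given distinct labels ℓ < 2c, read as a color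
-- ⌊ℓ/2⌋ < c and a direction (up for even ℓ, down for odd ℓ), so that no non-root vertex gives a
-- child its own color with the opposite direction.  The tree edges of one color, directed
-- child → parent at up children and parent → child at down children, then form vertex-disjoint
-- directed paths, and by pigeonhole some color has at least (n - 1)/c of these edges.  Orient
-- them along the paths and every other edge of G towards the smaller key, for a key increasing
-- along the paths.  Every out-neighbor of a vertex other than its successor then has a smaller
-- key, so by induction on the key each vertex is forced by its predecessor, and the path starts,
-- at most n - (n - 1)/c of them, form a forcing set.

open import Defs hiding (sym)
open import Data.Nat
  using (ℕ; zero; suc; pred; _+_; _*_; _∸_; _⊔_; _≡ᵇ_; ⌊_/2⌋; ⌈_/2⌉; _≤_; _<_; z≤n; s≤s; s≤s⁻¹; z<s;
         ≢-nonZero)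
open import Data.Nat.Properties
open import Data.Nat.ListAction using (sum)
open import Data.Nat.Solver using (module +-*-Solver)
open import Data.Fin using (Fin; zero; suc; toℕ)
open import Data.Fin.Properties using (any?; toℕ<n; toℕ-injective)
  renaming (suc-injective to Fin-suc-injective; _≟_ to _≟ᶠ_)
open import Data.Bool using (Bool; true; false; if_then_else_; _∧_; _∨_; not; _xor_)
open import Data.Bool.Properties
  using (∨-zeroʳ; ∧-zeroʳ; ∧-conicalˡ; ∧-conicalʳ; not-injective; not-¬) renaming (_≟_ to _≟ᵇ_)
open import Data.Bool.ListAction using (or)
open import Data.List using (List; _∷_; map; foldr; allFin)
open import Data.List.Properties using (map-tabulate)
open import Data.List.Membership.Propositional using (_∈_)
open import Data.List.Membership.Propositional.Properties using (∈-map⁺; ∈-allFin)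
open import Data.List.Relation.Unary.Any using (here; there)
open import Data.Product using (_×_; ∃; _,_; proj₁; proj₂)
open import Data.Sum using (_⊎_; inj₁; inj₂)
open import Data.Empty using (⊥-elim)
open import Function using (case_of_)
open import Relation.Nullary using (Dec; yes; no; does; ¬?; _×-dec_; _⊎-dec_)
open import Relation.Nullary.Decidable using (dec-true; dec-false)
open import Relation.Binary.Definitions using (tri<; tri≈; tri>)
open import Relation.Binary.PropositionalEquality

open +-*-Solver using (solve; _:+_; _:*_; _:=_; con)

_==_ : {n : ℕ} → Fin n → Fin n → Bool
u == v = does (u ≟ᶠ v)

==-refl : {n : ℕ} (u : Fin n) → (u == u) ≡ true
==-refl u = dec-true (u ≟ᶠ u) refl

does⇒ : {A : Set} (a? : Dec A) → does a? ≡ true → A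
does⇒ (yes a) _ = a

==⇒≡ : {n : ℕ} {u v : Fin n} → (u == v) ≡ true → u ≡ v
==⇒≡ {u = u} {v} = does⇒ (u ≟ᶠ v)

≢⇒==false : {n : ℕ} {u v : Fin n} → u ≢ v → (u == v) ≡ false
≢⇒==false {u = u} {v} = dec-false (u ≟ᶠ v)

indicator : Bool → ℕ
indicator b = if b then 1 else 0

count-suc : {n : ℕ} (p : Fin (suc n) → Bool) →
            count p ≡ indicator (p zero) + count (λ i → p (suc i))
count-suc {n} p = cong (λ xs → indicator (p zero) + sum xs)
  (trans (map-tabulate suc f) (sym (map-tabulate (λ i → i) (λ i → f (suc i)))))
  where f = λ v → indicator (p v)

indicator-mono : {a b : Bool} → (a ≡ true → b ≡ true) → indicator a ≤ indicator b
indicator-mono {false} _   = z≤n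
indicator-mono {true}  a⇒b rewrite a⇒b refl = ≤-refl

count-mono : {n : ℕ} {p q : Fin n → Bool} →
             (∀ v → p v ≡ true → q v ≡ true) → count p ≤ count q
count-mono {zero}  _ = z≤n
count-mono {suc n} {p} {q} p⊆q rewrite count-suc p | count-suc q =
  +-mono-≤ (indicator-mono (p⊆q zero)) (count-mono (λ v → p⊆q (suc v)))

count-< : {n : ℕ} {p q : Fin n → Bool} → (∀ v → p v ≡ true → q v ≡ true) →
          (v : Fin n) → q v ≡ true → p v ≡ false → count p < count q
count-< {suc n} {p} {q} p⊆q zero qv pv rewrite count-suc p | count-suc q | qv | pv =
  s≤s (count-mono (λ v → p⊆q (suc v)))
count-< {suc n} {p} {q} p⊆q (suc v) qv pv rewrite count-suc p | count-suc q =
  +-mono-≤-< (indicator-mono (p⊆q zero)) (count-< (λ w → p⊆q (suc w)) v qv pv)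

count-zero : {n : ℕ} (p : Fin n → Bool) → (∀ v → p v ≡ false) → count p ≡ 0
count-zero {zero}  p _     = refl
count-zero {suc n} p empty rewrite count-suc p | empty zero =
  count-zero (λ v → p (suc v)) (λ v → empty (suc v))

count-pos : {n : ℕ} (p : Fin n → Bool) (v : Fin n) → p v ≡ true → 1 ≤ count p
count-pos {n} p v pv =
  subst (_< count p) (count-zero {n} (λ _ → false) (λ _ → refl))
    (count-< {p = λ _ → false} (λ _ ()) v pv refl)

count-unique : {n : ℕ} (p : Fin n → Bool) (v : Fin n) → p v ≡ true →
               (∀ w → p w ≡ true → w ≡ v) → count p ≡ 1
count-unique p zero pv only rewrite count-suc p | pv =
  cong suc (count-zero (λ w → p (suc w)) rest-false)
  where
  rest-false : ∀ w → p (suc w) ≡ false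
  rest-false w with p (suc w) in pw
  ... | false = refl
  ... | true with only (suc w) pw
  ...   | ()
count-unique p (suc v) pv only rewrite count-suc p with p zero in p0
... | true with only zero p0
...   | ()
count-unique p (suc v) pv only | false =
  count-unique (λ w → p (suc w)) v pv (λ w pw → Fin-suc-injective (only (suc w) pw))

count-split : {n : ℕ} (p b : Fin n → Bool) →
              count p ≡ count (λ v → p v ∧ b v) + count (λ v → p v ∧ not (b v))
count-split {zero}  p b = refl
count-split {suc n} p b
  rewrite count-suc p | count-suc (λ v → p v ∧ b v) | count-suc (λ v → p v ∧ not (b v))
        | count-split (λ v → p (suc v)) (λ v → b (suc v))
  with p zero | b zero
... | true  | true  = refl
... | true  | false = sym (+-suc _ _)
... | false | _     = refl

count-remove : {n : ℕ} (p : Fin n → Bool) (a : Fin n) → p a ≡ true →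
               count p ≡ suc (count (λ w → p w ∧ not (w == a)))
count-remove p a pa = trans (count-split p (_== a))
  (cong (_+ count (λ w → p w ∧ not (w == a)))
    (count-unique (λ w → p w ∧ (w == a)) a (cong₂ _∧_ pa (==-refl a))
      (λ w pw → ==⇒≡ (∧-conicalʳ (p w) _ pw))))

count-injection : {n m : ℕ} (p : Fin n → Bool) (q : Fin m → Bool) (φ : Fin n → Fin m) →
                  (∀ v → p v ≡ true → q (φ v) ≡ true) →
                  (∀ v w → p v ≡ true → p w ≡ true → φ v ≡ φ w → v ≡ w) →
                  count p ≤ count q
count-injection {zero} _ _ _ _ _ = z≤n
count-injection {suc n} p q φ maps inj rewrite count-suc p with p zero in p0
... | false = count-injection (λ v → p (suc v)) q (λ v → φ (suc v)) (λ v → maps (suc v))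
                (λ v w pv pw eq → Fin-suc-injective (inj (suc v) (suc w) pv pw eq))
... | true = subst (suc (count (λ v → p (suc v))) ≤_) (sym (count-remove q (φ zero) (maps zero p0)))
               (s≤s (count-injection (λ v → p (suc v)) q′ (λ v → φ (suc v)) maps′
                 (λ v w pv pw eq → Fin-suc-injective (inj (suc v) (suc w) pv pw eq))))
  where
  q′ : Fin _ → Bool
  q′ w = q w ∧ not (w == φ zero)
  maps′ : ∀ v → p (suc v) ≡ true → q′ (φ (suc v)) ≡ true
  maps′ v pv = cong₂ _∧_ (maps (suc v) pv)
    (cong not (≢⇒==false (λ eq → case inj (suc v) zero pv p0 eq of λ ())))

count-all : {n : ℕ} → count {n} (λ _ → true) ≡ n
count-all {zero}  = refl
count-all {suc n} = trans (count-suc {n} (λ _ → true)) (cong suc (count-all {n}))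

position : {n : ℕ} → (Fin n → Bool) → Fin n → ℕ
position p v = count (λ w → p w ∧ does (toℕ w <? toℕ v))

position-excludes-self : {n : ℕ} (p : Fin n → Bool) (v : Fin n) → (p v ∧ does (toℕ v <? toℕ v)) ≡ false
position-excludes-self p v rewrite dec-false (toℕ v <? toℕ v) (<-irrefl refl) = ∧-zeroʳ (p v)

position-< : {n : ℕ} (p : Fin n → Bool) (v : Fin n) → p v ≡ true → position p v < count p
position-< p v pv = count-< (λ w → ∧-conicalˡ (p w) _) v pv (position-excludes-self p v)

position-monotone : {n : ℕ} (p : Fin n → Bool) (v w : Fin n) → p v ≡ true →
                    toℕ v < toℕ w → position p v < position p w
position-monotone p v w pv v<w = count-<
  (λ x x<v → cong₂ _∧_ (∧-conicalˡ (p x) _ x<v)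
     (dec-true (toℕ x <? toℕ w) (<-trans (does⇒ (toℕ x <? toℕ v) (∧-conicalʳ (p x) _ x<v)) v<w)))
  v (cong₂ _∧_ pv (dec-true (toℕ v <? toℕ w) v<w)) (position-excludes-self p v)

position-injective : {n : ℕ} (p : Fin n → Bool) (v w : Fin n) → p v ≡ true → p w ≡ true →
                     position p v ≡ position p w → v ≡ w
position-injective p v w pv pw same with <-cmp (toℕ v) (toℕ w)
... | tri< v<w _ _ = ⊥-elim (<-irrefl same (position-monotone p v w pv v<w))
... | tri≈ _ v≡w _ = toℕ-injective v≡w
... | tri> _ _ w<v = ⊥-elim (<-irrefl (sym same) (position-monotone p w v pw w<v))

pigeonhole : {n : ℕ} (c : ℕ) (p : Fin n → Bool) (f : Fin n → ℕ) →
             (∀ v → p v ≡ true → f v < c) →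
             ∃ λ γ → count p ≤ c * count (λ v → p v ∧ does (f v ≟ γ))
pigeonhole zero p f bounded = 0 , ≤-reflexive (count-zero p none)
  where
  none : ∀ v → p v ≡ false
  none v with p v in pv
  ... | false = refl
  ... | true  = ⊥-elim (n≮0 (bounded v pv))
pigeonhole (suc c) p f bounded = larger-class (pigeonhole c rest f rest-bounded)
  where
  at : ℕ → Fin _ → Bool
  at x v = p v ∧ does (f v ≟ x)
  rest : Fin _ → Bool
  rest v = p v ∧ not (does (f v ≟ c))
  rest-bounded : ∀ v → rest v ≡ true → f v < c
  rest-bounded v rv =
    ≤∧≢⇒< (s≤s⁻¹ (bounded v (∧-conicalˡ _ _ rv))) (does⇒ (¬? (f v ≟ c)) (∧-conicalʳ (p v) _ rv))
  larger-class : (∃ λ γ → count rest ≤ c * count (λ v → rest v ∧ does (f v ≟ γ))) →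
                 ∃ λ δ → count p ≤ suc c * count (at δ)
  larger-class (γ , rest≤) = larger (≤-total (count (at c)) (count (at γ)))
    where
    split : count p ≤ count (at c) + c * count (at γ)
    split = begin
      count p                                        ≡⟨ count-split p (λ v → does (f v ≟ c)) ⟩
      count (at c) + count rest                      ≤⟨ +-monoʳ-≤ (count (at c)) rest≤ ⟩
      count (at c) + c * count (λ v → rest v ∧ does (f v ≟ γ))
                                                     ≤⟨ +-monoʳ-≤ (count (at c)) (*-monoʳ-≤ c (count-mono rest-at⊆at)) ⟩
      count (at c) + c * count (at γ)                ∎
      where
      open ≤-Reasoning
      rest-at⊆at : ∀ v → (rest v ∧ does (f v ≟ γ)) ≡ true → at γ v ≡ true
      rest-at⊆at v h = cong₂ _∧_ (∧-conicalˡ (p v) _ (∧-conicalˡ _ _ h)) (∧-conicalʳ (rest v) _ h)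
    larger : count (at c) ≤ count (at γ) ⊎ count (at γ) ≤ count (at c) →
             ∃ λ δ → count p ≤ suc c * count (at δ)
    larger (inj₁ c≤γ) = γ , ≤-trans split (+-monoˡ-≤ (c * count (at γ)) c≤γ)
    larger (inj₂ γ≤c) = c , ≤-trans split (+-monoʳ-≤ (count (at c)) (*-monoʳ-≤ c γ≤c))

anyV-suc : {n : ℕ} (p : Fin (suc n) → Bool) → anyV p ≡ (p zero ∨ anyV (λ i → p (suc i)))
anyV-suc {n} p = cong (λ bs → p zero ∨ or bs)
  (trans (map-tabulate suc p) (sym (map-tabulate (λ i → i) (λ i → p (suc i)))))

anyV-intro : {n : ℕ} (p : Fin n → Bool) (v : Fin n) → p v ≡ true → anyV p ≡ true
anyV-intro p zero    pv rewrite anyV-suc p | pv = refl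
anyV-intro p (suc v) pv rewrite anyV-suc p | anyV-intro (λ i → p (suc i)) v pv = ∨-zeroʳ (p zero)

anyV-witness : {n : ℕ} (p : Fin n → Bool) → anyV p ≡ true → ∃ λ v → p v ≡ true
anyV-witness {suc n} p any rewrite anyV-suc p with p zero in p0
... | true  = zero , p0
... | false with anyV-witness (λ i → p (suc i)) any
...   | v , pv = suc v , pv

choose : {n : ℕ} → (Fin n → Bool) → Fin n → Fin n
choose p default with any? (λ v → p v ≟ᵇ true)
... | yes (v , _) = v
... | no _        = default

choose-spec : {n : ℕ} (p : Fin n → Bool) (default : Fin n) → anyV p ≡ true →
              p (choose p default) ≡ true
choose-spec p default any with any? (λ v → p v ≟ᵇ true)
... | yes (_ , pv) = pv
... | no none      = ⊥-elim (none (anyV-witness p any))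

≤-foldr-⊔ : {x : ℕ} {xs : List ℕ} → x ∈ xs → x ≤ foldr _⊔_ 0 xs
≤-foldr-⊔ {xs = y ∷ ys} (here refl) = m≤m⊔n y _
≤-foldr-⊔ {xs = y ∷ ys} (there x∈ys) = ≤-trans (≤-foldr-⊔ x∈ys) (m≤n⊔m y _)

≤-max-over : {n : ℕ} (f : Fin n → ℕ) (v : Fin n) → f v ≤ foldr _⊔_ 0 (map f (allFin n))
≤-max-over f v = ≤-foldr-⊔ (∈-map⁺ f (∈-allFin v))

least : (ℕ → Bool) → ℕ → ℕ
least f zero    = 0
least f (suc b) = if f 0 then 0 else suc (least (λ i → f (suc i)) b)

least-holds : (f : ℕ → Bool) (b : ℕ) → f b ≡ true → f (least f b) ≡ true
least-holds f zero    fb = fb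
least-holds f (suc b) fb with f 0 in f0
... | true  = f0
... | false = least-holds (λ i → f (suc i)) b fb

least-≤ : (f : ℕ → Bool) (b i : ℕ) → f i ≡ true → least f b ≤ i
least-≤ f zero    i       fi = z≤n
least-≤ f (suc b) i       fi with f 0 in f0
... | true = z≤n
least-≤ f (suc b) zero    fi | false with trans (sym f0) fi
...   | ()
least-≤ f (suc b) (suc i) fi | false = s≤s (least-≤ (λ j → f (suc j)) b i fi)

record RootedSpanningTree {n : ℕ} (G : Graph n) : Set where
  field
    root         : Fin n
    parent       : Fin n → Fin n
    depth        : Fin n → ℕ
    depth-root   : depth root ≡ 0
    depth-parent : ∀ v → v ≢ root → depth v ≡ suc (depth (parent v))
    parent-edge  : ∀ v → v ≢ root → Edge G (parent v) v

module BreadthFirst {n : ℕ} (G : Graph n) (root : Fin n) (connected : Connected (Edge G)) where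

  within : ℕ → Fin n → Bool
  within zero    v = v == root
  within (suc k) v = within k v ∨ anyV (λ u → within k u ∧ adj G u v)

  within-step : ∀ k u v → within k u ≡ true → Edge G u v → within (suc k) v ≡ true
  within-step k u v wu uv =
    trans (cong (within k v ∨_) (anyV-intro (λ w → within k w ∧ adj G w v) u (cong₂ _∧_ wu uv)))
          (∨-zeroʳ (within k v))

  reach⇒within : ∀ v → Reach (Edge G) v root → ∃ λ k → within k v ≡ true
  reach⇒within v here = 0 , ==-refl root
  reach⇒within v (step {v = w} vw w↝root) with reach⇒within w w↝root
  ... | k , wk = suc k , within-step k w v wk (trans (Graph.sym G w v) vw)

  depth : Fin n → ℕ
  depth v = least (λ k → within k v) (proj₁ (reach⇒within v (connected v root)))

  depth-within : ∀ v → within (depth v) v ≡ true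
  depth-within v = least-holds (λ k → within k v) (proj₁ reached) (proj₂ reached)
    where reached = reach⇒within v (connected v root)

  depth-≤ : ∀ v k → within k v ≡ true → depth v ≤ k
  depth-≤ v k = least-≤ (λ k → within k v) (proj₁ (reach⇒within v (connected v root))) k

  depth-root : depth root ≡ 0
  depth-root = n≤0⇒n≡0 (depth-≤ root 0 (==-refl root))

  parent : Fin n → Fin n
  parent v = choose (λ u → within (pred (depth v)) u ∧ adj G u v) root

  module _ (v : Fin n) (v≢root : v ≢ root) where

    depth≢0 : depth v ≢ 0
    depth≢0 dv = v≢root (==⇒≡ (subst (λ k → within k v ≡ true) dv (depth-within v)))

    d : ℕ
    d = pred (depth v)

    depth≡suc-d : depth v ≡ suc d
    depth≡suc-d = sym (suc-pred (depth v) {{≢-nonZero depth≢0}})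

    parent-spec : (within d (parent v) ∧ adj G (parent v) v) ≡ true
    parent-spec = choose-spec _ root reached-from-d
      where
      not-within : within d v ≡ false
      not-within with within d v in wd
      ... | false = refl
      ... | true  = ⊥-elim (1+n≰n (subst (_≤ d) depth≡suc-d (depth-≤ v d wd)))
      reached-from-d : anyV (λ u → within d u ∧ adj G u v) ≡ true
      reached-from-d = subst (λ b → (b ∨ anyV (λ u → within d u ∧ adj G u v)) ≡ true) not-within
                         (subst (λ k → within k v ≡ true) depth≡suc-d (depth-within v))

    parent-edge : Edge G (parent v) v
    parent-edge = ∧-conicalʳ _ _ parent-spec

    depth-parent : depth v ≡ suc (depth (parent v))
    depth-parent = trans depth≡suc-d (cong suc (≤-antisym below above))
      where
      above : depth (parent v) ≤ d
      above = depth-≤ (parent v) d (∧-conicalˡ _ _ parent-spec)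
      below : d ≤ depth (parent v)
      below = s≤s⁻¹ (begin
        suc d                   ≡⟨ depth≡suc-d ⟨
        depth v                 ≤⟨ depth-≤ v _ reached ⟩
        suc (depth (parent v))  ∎)
        where
        open ≤-Reasoning
        reached = within-step (depth (parent v)) (parent v) v (depth-within (parent v)) parent-edge

  tree : RootedSpanningTree G
  tree = record
    { root = root ; parent = parent ; depth = depth ; depth-root = depth-root
    ; depth-parent = depth-parent ; parent-edge = parent-edge }

xor-of-exclusive : ∀ a b g g′ → (a ∧ b) ≡ false → (g xor g′) ≡ true →
                   ((a ∨ (not b ∧ g)) xor (b ∨ (not a ∧ g′))) ≡ true
xor-of-exclusive true  true  g g′ ()
xor-of-exclusive true  false g g′ _ _ = refl
xor-of-exclusive false true  g g′ _ _ = refl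
xor-of-exclusive false false g g′ _ g⊕g′ = g⊕g′

module SuccessorForcing {n : ℕ} (G : Graph n) (next : Fin n → Fin n → Bool) (key : Fin n → ℕ)
  (next⇒edge       : ∀ u v → next u v ≡ true → Edge G u v)
  (next-functional : ∀ u v w → next u v ≡ true → next u w ≡ true → v ≡ w)
  (key-injective   : ∀ u v → key u ≡ key v → u ≡ v)
  (next-increasing : ∀ u v → next u v ≡ true → key u < key v) where

  forward : Fin n → Fin n → Bool
  forward u v = adj G u v ∧ (next u v ∨ (not (next v u) ∧ does (key v <? key u)))

  next-not-symmetric : ∀ u v → (next u v ∧ next v u) ≡ false
  next-not-symmetric u v with next u v in uv | next v u in vu
  ... | false | _    = refl
  ... | true  | false = refl
  ... | true  | true  = ⊥-elim (<-asym (next-increasing u v uv) (next-increasing v u vu))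

  key-comparable : ∀ u v → u ≢ v → (does (key v <? key u) xor does (key u <? key v)) ≡ true
  key-comparable u v u≢v with <-cmp (key u) (key v)
  ... | tri< u<v _ v≮u rewrite dec-false (key v <? key u) v≮u | dec-true (key u <? key v) u<v = refl
  ... | tri≈ _ u≡v _ = ⊥-elim (u≢v (key-injective u v u≡v))
  ... | tri> u≮v _ v<u rewrite dec-true (key v <? key u) v<u | dec-false (key u <? key v) u≮v = refl

  forward⇒next-or-lower : ∀ u w → forward u w ≡ true → next u w ≡ true ⊎ key w < key u
  forward⇒next-or-lower u w fw with next u w
  ... | true  = inj₁ refl
  ... | false = inj₂ (does⇒ (key w <? key u) (∧-conicalʳ (not (next w u)) _ (∧-conicalʳ (adj G u w) _ fw)))

  orientation : Orientation G
  orientation = record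
    { arc     = forward
    ; arc⇒adj = λ u v → ∧-conicalˡ _ _
    ; oneDir  = one-direction }
    where
    one-direction : ∀ u v → adj G u v ≡ true → (forward u v xor forward v u) ≡ true
    one-direction u v uv rewrite uv | trans (Graph.sym G v u) uv =
      xor-of-exclusive (next u v) (next v u) _ _ (next-not-symmetric u v)
        (key-comparable u v (λ { refl → case trans (sym uv) (Graph.irrefl G u) of λ () }))

  starts : Fin n → Bool
  starts v = not (anyV (λ u → next u v))

  colored : ℕ → Fin n → Bool
  colored k = iterate (forceStep orientation) k starts

  colored-suc : ∀ k v → colored k v ≡ true → colored (suc k) v ≡ true
  colored-suc k v c = cong (_∨ anyV (λ u → forces orientation (colored k) u v)) c

  starts-colored : ∀ k v → starts v ≡ true → colored k v ≡ true
  starts-colored zero    v s = s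
  starts-colored (suc k) v s = colored-suc k v (starts-colored k v s)

  forces-successor : ∀ k u v → colored k u ≡ true → next u v ≡ true →
                     (∀ w → key w < key u → colored k w ≡ true) → colored (suc k) v ≡ true
  forces-successor k u v cu uv below = colored-or-forced (colored k v) refl
    where
    forward-uv : forward u v ≡ true
    forward-uv = cong₂ _∧_ (next⇒edge u v uv) (cong (_∨ (not (next v u) ∧ does (key v <? key u))) uv)
    colored-or-forced : ∀ b → colored k v ≡ b → colored (suc k) v ≡ true
    colored-or-forced true  cv = colored-suc k v cv
    colored-or-forced false cv =
      trans (cong (colored k v ∨_) (anyV-intro (λ x → forces orientation (colored k) x v) u u⇒v))
            (∨-zeroʳ (colored k v))
      where
      only-v : ∀ w → (forward u w ∧ not (colored k w)) ≡ true → w ≡ v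
      only-v w h with forward⇒next-or-lower u w (∧-conicalˡ (forward u w) _ h)
      ... | inj₁ uw  = next-functional u w v uw uv
      ... | inj₂ w<u =
        ⊥-elim (case trans (sym (below w w<u)) (not-injective (∧-conicalʳ (forward u w) _ h)) of λ ())
      u⇒v : forces orientation (colored k) u v ≡ true
      u⇒v = cong₂ _∧_ cu (cong₂ _∧_ forward-uv (cong₂ _∧_ (cong not cv)
              (cong (_≡ᵇ 1) (count-unique _ v (cong₂ _∧_ forward-uv (cong not cv)) only-v))))

  mutual
    colored-by-key : ∀ k v → key v ≤ k → colored k v ≡ true
    colored-by-key k v kv≤k with anyV (λ u → next u v) in hasPred
    ... | false = starts-colored k v (cong not hasPred)
    ... | true with anyV-witness _ hasPred
    ...   | u , uv = colored-after-predecessor k u v uv (<-≤-trans (next-increasing u v uv) kv≤k)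

    colored-after-predecessor : ∀ k u v → next u v ≡ true → key u < k → colored k v ≡ true
    colored-after-predecessor (suc k) u v uv (s≤s ku≤k) =
      forces-successor k u v (colored-by-key k u ku≤k) uv
        (λ w kw<ku → colored-by-key k w (≤-trans (<⇒≤ kw<ku) ku≤k))

  start-exists : ∀ k v → key v < k → ∃ λ s → starts s ≡ true
  start-exists (suc k) v (s≤s kv≤k) with anyV (λ u → next u v) in hasPred
  ... | false = v , cong not hasPred
  ... | true with anyV-witness _ hasPred
  ...   | u , uv = start-exists k u (<-≤-trans (next-increasing u v uv) kv≤k)

  starts-forcing : Fin n → IsForcingSet orientation starts
  starts-forcing v with start-exists (suc (key v)) v ≤-refl
  ... | s , s-starts =
    count-pos starts s s-starts , maxKey , λ w → colored-by-key maxKey w (≤-max-over key w)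
    where maxKey = foldr _⊔_ 0 (map key (allFin n))

  predecessors+starts : count (λ v → anyV (λ u → next u v)) + count starts ≡ n
  predecessors+starts = trans (sym (count-split (λ _ → true) (λ v → anyV (λ u → next u v)))) count-all

lexKey : {n : ℕ} → (Fin n → ℕ) → Fin n → ℕ
lexKey {n} rank v = rank v * n + toℕ v

lexKey-monotone : {n : ℕ} (rank : Fin n → ℕ) (u v : Fin n) →
                  rank u < rank v → lexKey rank u < lexKey rank v
lexKey-monotone {n} rank u v ru<rv = begin-strict
  rank u * n + toℕ u  <⟨ +-monoʳ-< (rank u * n) (toℕ<n u) ⟩
  rank u * n + n      ≡⟨ +-comm (rank u * n) n ⟩
  suc (rank u) * n    ≤⟨ *-monoˡ-≤ n ru<rv ⟩
  rank v * n          ≤⟨ m≤m+n (rank v * n) (toℕ v) ⟩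
  rank v * n + toℕ v  ∎
  where open ≤-Reasoning

lexKey-injective : {n : ℕ} (rank : Fin n → ℕ) (u v : Fin n) →
                   lexKey rank u ≡ lexKey rank v → u ≡ v
lexKey-injective {n} rank u v same with <-cmp (rank u) (rank v)
... | tri< ru<rv _ _ = ⊥-elim (<-irrefl same (lexKey-monotone rank u v ru<rv))
... | tri> _ _ rv<ru = ⊥-elim (<-irrefl (sym same) (lexKey-monotone rank v u rv<ru))
... | tri≈ _ ru≡rv _ rewrite ru≡rv = toℕ-injective (+-cancelˡ-≡ (rank v * n) (toℕ u) (toℕ v) same)

skip : ℕ → ℕ → ℕ
skip f i with f ≤? i
... | yes _ = suc i
... | no  _ = i

skip-≢ : ∀ f i → skip f i ≢ f
skip-≢ f i with f ≤? i
... | yes f≤i = λ eq → 1+n≰n (subst (_≤ i) (sym eq) f≤i)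
... | no  f≰i = λ eq → f≰i (≤-reflexive (sym eq))

skip-≤ : ∀ f i → skip f i ≤ suc i
skip-≤ f i with f ≤? i
... | yes _ = ≤-refl
... | no  _ = n≤1+n i

skip-injective : ∀ f i j → skip f i ≡ skip f j → i ≡ j
skip-injective f i j eq with f ≤? i | f ≤? j
... | yes _   | yes _   = suc-injective eq
... | no  _   | no  _   = eq
... | yes f≤i | no  f≰j = ⊥-elim (f≰j (≤-trans f≤i (≤-trans (n≤1+n i) (≤-reflexive eq))))
... | no  f≰i | yes f≤j = ⊥-elim (f≰i (≤-trans f≤j (≤-trans (n≤1+n j) (≤-reflexive (sym eq)))))

even : ℕ → Bool
even zero          = true
even (suc zero)    = false
even (suc (suc m)) = even m

partner : ℕ → ℕ
partner zero          = 1
partner (suc zero)    = 0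
partner (suc (suc ℓ)) = suc (suc (partner ℓ))

even-partner : ∀ ℓ → even (partner ℓ) ≡ not (even ℓ)
even-partner zero          = refl
even-partner (suc zero)    = refl
even-partner (suc (suc ℓ)) = even-partner ℓ

same-half : ∀ a b → ⌊ a /2⌋ ≡ ⌊ b /2⌋ → a ≡ b ⊎ a ≡ partner b
same-half zero          zero          _  = inj₁ refl
same-half zero          (suc zero)    _  = inj₂ refl
same-half (suc zero)    zero          _  = inj₂ refl
same-half (suc zero)    (suc zero)    _  = inj₁ refl
same-half (suc (suc a)) (suc (suc b)) eq with same-half a b (suc-injective eq)
... | inj₁ a≡b        = inj₁ (cong (λ x → suc (suc x)) a≡b)
... | inj₂ a≡partnerb = inj₂ (cong (λ x → suc (suc x)) a≡partnerb)

⌊/2⌋-< : ∀ a c → a < c + c → ⌊ a /2⌋ < c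
⌊/2⌋-< zero          (suc c) _ = z<s
⌊/2⌋-< (suc zero)    (suc c) _ = z<s
⌊/2⌋-< (suc (suc a)) (suc c) (s≤s a+1<c+c) =
  s≤s (⌊/2⌋-< a c (s≤s⁻¹ (subst (suc (suc a) ≤_) (+-suc c c) a+1<c+c)))

module ChildLabels {n : ℕ} {G : Graph n} (T : RootedSpanningTree G) where
  open RootedSpanningTree T

  nonroot : Fin n → Bool
  nonroot v = not (v == root)

  nonroot⇒≢ : ∀ {v} → nonroot v ≡ true → v ≢ root
  nonroot⇒≢ {v} nr refl = case trans (sym nr) (cong not (==-refl root)) of λ ()

  ≢⇒nonroot : ∀ {v} → v ≢ root → nonroot v ≡ true
  ≢⇒nonroot v≢root = cong not (≢⇒==false v≢root)

  count-nonroot : suc (count nonroot) ≡ n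
  count-nonroot = trans (sym (count-remove (λ _ → true) root refl)) count-all

  isChild : Fin n → Fin n → Bool
  isChild u w = nonroot w ∧ (parent w == u)

  isChild-parent : ∀ v → v ≢ root → isChild (parent v) v ≡ true
  isChild-parent v v≢root = cong₂ _∧_ (≢⇒nonroot v≢root) (==-refl (parent v))

  child-edge : ∀ u w → isChild u w ≡ true → Edge G u w
  child-edge u w uw = subst (λ x → Edge G x w) (==⇒≡ (∧-conicalʳ (nonroot w) _ uw))
                        (parent-edge w (nonroot⇒≢ (∧-conicalˡ _ _ uw)))

  parent-not-child : ∀ u → u ≢ root → isChild u (parent u) ≡ false
  parent-not-child u u≢root with isChild u (parent u) in pu
  ... | false = refl
  ... | true  = ⊥-elim (1+n≰n (≤-trans (n≤1+n (suc (depth u))) (≤-reflexive (sym cycle))))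
    where
    pp≡u = ==⇒≡ (∧-conicalʳ (nonroot (parent u)) _ pu)
    cycle : depth u ≡ suc (suc (depth u))
    cycle = trans (depth-parent u u≢root)
              (cong suc (trans (depth-parent (parent u) (nonroot⇒≢ (∧-conicalˡ _ _ pu)))
                               (cong (λ x → suc (depth x)) pp≡u)))

  children-of-root : count (isChild root) ≤ degree G root
  children-of-root = count-mono (child-edge root)

  children-of-nonroot : ∀ u → u ≢ root → suc (count (isChild u)) ≤ degree G u
  children-of-nonroot u u≢root = count-< (child-edge u) (parent u)
    (trans (Graph.sym G u (parent u)) (parent-edge u u≢root)) (parent-not-child u u≢root)

  childIndex : Fin n → ℕ
  childIndex v = position (isChild (parent v)) v

  -- The label of the i-th child of a vertex of depth d and label ℓ; only a non-root vertex
  -- withholds a label, namely the partner of its own.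
  slotAt : ℕ → ℕ → ℕ → ℕ
  slotAt zero    ℓ i = i
  slotAt (suc _) ℓ i = skip (partner ℓ) i

  labelAt : ℕ → Fin n → ℕ
  labelAt zero    v = 0
  labelAt (suc d) v = slotAt d (labelAt d (parent v)) (childIndex v)

  label : Fin n → ℕ
  label v = labelAt (depth v) v

  slot : Fin n → ℕ → ℕ
  slot u = slotAt (depth u) (label u)

  label-child : ∀ v → v ≢ root → label v ≡ slot (parent v) (childIndex v)
  label-child v v≢root rewrite depth-parent v v≢root = refl

  slot-root : ∀ i → slot root i ≡ i
  slot-root i rewrite depth-root = refl

  slot-nonroot : ∀ u i → u ≢ root → slot u i ≡ skip (partner (label u)) i
  slot-nonroot u i u≢root rewrite depth-parent u u≢root = refl

  slot-injective : ∀ u i j → slot u i ≡ slot u j → i ≡ j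
  slot-injective u i j with depth u
  ... | zero  = λ eq → eq
  ... | suc _ = skip-injective _ i j

  label-< : ∀ c → (∀ u → degree G u ≤ c + c) → ∀ v → v ≢ root → label v < c + c
  label-< c degree≤ v v≢root with parent v ≟ᶠ root
  ... | yes p≡root = begin-strict
    label v                     ≡⟨ label-child v v≢root ⟩
    slot (parent v) (childIndex v) ≡⟨ cong (λ u → slot u (childIndex v)) p≡root ⟩
    slot root (childIndex v)    ≡⟨ slot-root (childIndex v) ⟩
    childIndex v                <⟨ position-< (isChild (parent v)) v (isChild-parent v v≢root) ⟩
    count (isChild (parent v))  ≡⟨ cong (λ u → count (isChild u)) p≡root ⟩
    count (isChild root)        ≤⟨ children-of-root ⟩
    degree G root               ≤⟨ degree≤ root ⟩
    c + c                       ∎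
    where open ≤-Reasoning
  ... | no p≢root = begin-strict
    label v                          ≡⟨ label-child v v≢root ⟩
    slot (parent v) (childIndex v)   ≡⟨ slot-nonroot (parent v) (childIndex v) p≢root ⟩
    skip (partner (label (parent v))) (childIndex v) ≤⟨ skip-≤ _ (childIndex v) ⟩
    suc (childIndex v)               <⟨ s≤s (position-< (isChild (parent v)) v (isChild-parent v v≢root)) ⟩
    suc (count (isChild (parent v))) ≤⟨ children-of-nonroot (parent v) p≢root ⟩
    degree G (parent v)              ≤⟨ degree≤ (parent v) ⟩
    c + c                            ∎
    where open ≤-Reasoning

  siblings-labels-distinct : ∀ v w → v ≢ root → w ≢ root → parent v ≡ parent w →
                             label v ≡ label w → v ≡ w
  siblings-labels-distinct v w v≢root w≢root pv≡pw same =
    position-injective (isChild (parent v)) v w (isChild-parent v v≢root)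
      (subst (λ u → isChild u w ≡ true) (sym pv≡pw) (isChild-parent w w≢root))
      (slot-injective (parent v) _ _ (begin
        slot (parent v) (childIndex v) ≡⟨ sym (label-child v v≢root) ⟩
        label v                        ≡⟨ same ⟩
        label w                        ≡⟨ label-child w w≢root ⟩
        slot (parent w) (childIndex w) ≡⟨ cong (λ u → slot u (position (isChild u) w)) pv≡pw ⟨
        slot (parent v) (position (isChild (parent v)) w) ∎))
    where open ≡-Reasoning

  child-avoids-partner : ∀ u w → u ≢ root → w ≢ root → parent w ≡ u → label w ≢ partner (label u)
  child-avoids-partner u w u≢root w≢root refl eq =
    skip-≢ (partner (label u)) (childIndex w)
      (trans (sym (slot-nonroot u (childIndex w) u≢root)) (trans (sym (label-child w w≢root)) eq))

  color : Fin n → ℕ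
  color v = ⌊ label v /2⌋

  upward : Fin n → Bool
  upward v = even (label v)

  color-< : ∀ c → (∀ u → degree G u ≤ c + c) → ∀ v → nonroot v ≡ true → color v < c
  color-< c degree≤ v nr = ⌊/2⌋-< (label v) c (label-< c degree≤ v (nonroot⇒≢ nr))

  siblings-distinct : ∀ v w → v ≢ root → w ≢ root → parent v ≡ parent w →
                      color v ≡ color w → upward v ≡ upward w → v ≡ w
  siblings-distinct v w v≢root w≢root pv≡pw cv≡cw uv≡uw with same-half (label v) (label w) cv≡cw
  ... | inj₁ lv≡lw = siblings-labels-distinct v w v≢root w≢root pv≡pw lv≡lw
  ... | inj₂ lv≡partner = ⊥-elim (not-¬ uv≡uw (trans (cong even lv≡partner) (even-partner (label w))))

  child-keeps-direction : ∀ u w → u ≢ root → w ≢ root → parent w ≡ u →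
                          color w ≡ color u → upward w ≡ upward u
  child-keeps-direction u w u≢root w≢root pw≡u cw≡cu with same-half (label w) (label u) cw≡cu
  ... | inj₁ lw≡lu      = cong even lw≡lu
  ... | inj₂ lw≡partner = ⊥-elim (child-avoids-partner u w u≢root w≢root pw≡u lw≡partner)

  maxDepth : ℕ
  maxDepth = foldr _⊔_ 0 (map depth (allFin n))

  -- Up vertices are ranked by decreasing depth and the others by increasing depth, so that rank
  -- increases along every path of a color class.
  rank : Fin n → ℕ
  rank v = if upward v then maxDepth ∸ depth v else maxDepth + depth v

  rank-upward : ∀ v → upward v ≡ true → rank v ≡ maxDepth ∸ depth v
  rank-upward v up rewrite up = refl

  rank-downward : ∀ v → upward v ≡ false → rank v ≡ maxDepth + depth v
  rank-downward v down rewrite down = refl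

  rank-≤ : ∀ v → rank v ≤ maxDepth + depth v
  rank-≤ v with upward v
  ... | true  = ≤-trans (m∸n≤m maxDepth (depth v)) (m≤m+n maxDepth (depth v))
  ... | false = ≤-refl

  rank-≥ : ∀ v → maxDepth ∸ depth v ≤ rank v
  rank-≥ v with upward v
  ... | true  = ≤-refl
  ... | false = ≤-trans (m∸n≤m maxDepth (depth v)) (m≤m+n maxDepth (depth v))

  module ColorClass (γ : ℕ) where

    Next : Fin n → Fin n → Set
    Next u v = (parent v ≡ u × v ≢ root × color v ≡ γ × upward v ≡ false)
             ⊎ (parent u ≡ v × u ≢ root × color u ≡ γ × upward u ≡ true)

    next? : ∀ u v → Dec (Next u v)
    next? u v = (parent v ≟ᶠ u ×-dec ¬? (v ≟ᶠ root) ×-dec color v ≟ γ ×-dec upward v ≟ᵇ false)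
          ⊎-dec (parent u ≟ᶠ v ×-dec ¬? (u ≟ᶠ root) ×-dec color u ≟ γ ×-dec upward u ≟ᵇ true)

    next : Fin n → Fin n → Bool
    next u v = does (next? u v)

    direction-continues : ∀ u w → u ≢ root → w ≢ root → parent w ≡ u →
                          color u ≡ γ → color w ≡ γ → upward w ≡ upward u
    direction-continues u w u≢root w≢root pw≡u cu cw =
      child-keeps-direction u w u≢root w≢root pw≡u (trans cw (sym cu))

    next⇒edge : ∀ u v → next u v ≡ true → Edge G u v
    next⇒edge u v uv with does⇒ (next? u v) uv
    ... | inj₁ (refl , v≢root , _) = parent-edge v v≢root
    ... | inj₂ (refl , u≢root , _) = trans (Graph.sym G u (parent u)) (parent-edge u u≢root)

    next-functional : ∀ u v w → next u v ≡ true → next u w ≡ true → v ≡ w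
    next-functional u v w uv uw with does⇒ (next? u v) uv | does⇒ (next? u w) uw
    ... | inj₂ (pu≡v , _) | inj₂ (pu≡w , _) = trans (sym pu≡v) pu≡w
    ... | inj₁ (pv≡u , v≢root , cv , dv) | inj₁ (pw≡u , w≢root , cw , dw) =
      siblings-distinct v w v≢root w≢root (trans pv≡u (sym pw≡u)) (trans cv (sym cw)) (trans dv (sym dw))
    ... | inj₁ (pv≡u , v≢root , cv , dv) | inj₂ (_ , u≢root , cu , du) =
      ⊥-elim (case trans (sym dv) (trans (direction-continues u v u≢root v≢root pv≡u cu cv) du) of λ ())
    ... | inj₂ (_ , u≢root , cu , du) | inj₁ (pw≡u , w≢root , cw , dw) =
      ⊥-elim (case trans (sym dw) (trans (direction-continues u w u≢root w≢root pw≡u cu cw) du) of λ ())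

    next-increases-rank : ∀ u v → next u v ≡ true → rank u < rank v
    next-increases-rank u v uv with does⇒ (next? u v) uv
    ... | inj₁ (refl , v≢root , _ , dv) = begin-strict
      rank u                      ≤⟨ rank-≤ u ⟩
      maxDepth + depth u          <⟨ +-monoʳ-< maxDepth (≤-reflexive (sym (depth-parent v v≢root))) ⟩
      maxDepth + depth v          ≡⟨ rank-downward v dv ⟨
      rank v                      ∎
      where open ≤-Reasoning
    ... | inj₂ (refl , u≢root , _ , du) = begin-strict
      rank u                     ≡⟨ rank-upward u du ⟩
      maxDepth ∸ depth u         <⟨ ∸-monoʳ-< (≤-reflexive (sym (depth-parent u u≢root))) (≤-max-over depth u) ⟩
      maxDepth ∸ depth (parent u) ≤⟨ rank-≥ (parent u) ⟩
      rank (parent u)            ∎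
      where open ≤-Reasoning

    member : Fin n → Bool
    member v = nonroot v ∧ does (color v ≟ γ)

    heads : Fin n → Bool
    heads v = anyV (λ u → next u v)

    member-≤-heads : count member ≤ count heads
    member-≤-heads = count-injection member heads head-of head-of-heads head-of-injective
      where
      head-of : Fin n → Fin n
      head-of v = if upward v then parent v else v

      unpack : ∀ v → member v ≡ true → v ≢ root × color v ≡ γ
      unpack v mv = nonroot⇒≢ (∧-conicalˡ _ _ mv) , does⇒ (color v ≟ γ) (∧-conicalʳ (nonroot v) _ mv)

      head-of-heads : ∀ v → member v ≡ true → heads (head-of v) ≡ true
      head-of-heads v mv with unpack v mv | upward v in dv
      ... | v≢root , cv | true  = anyV-intro (λ u → next u (parent v)) v
                                    (dec-true (next? v (parent v)) (inj₂ (refl , v≢root , cv , dv)))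
      ... | v≢root , cv | false = anyV-intro (λ u → next u v) (parent v)
                                    (dec-true (next? (parent v) v) (inj₁ (refl , v≢root , cv , dv)))

      head-of-injective : ∀ v w → member v ≡ true → member w ≡ true → head-of v ≡ head-of w → v ≡ w
      head-of-injective v w mv mw eq with unpack v mv | unpack w mw | upward v in dv | upward w in dw
      ... | v≢root , cv | w≢root , cw | true  | true  =
        siblings-distinct v w v≢root w≢root eq (trans cv (sym cw)) (trans dv (sym dw))
      ... | _ | _ | false | false = eq
      ... | v≢root , cv | w≢root , cw | true  | false =
        ⊥-elim (case trans (sym dv) (trans (direction-continues w v w≢root v≢root eq cw cv) dw) of λ ())
      ... | v≢root , cv | w≢root , cw | false | true  =
        ⊥-elim (case trans (sym dw) (trans (direction-continues v w v≢root w≢root (sym eq) cv cw) dv) of λ ())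

degree≤2⌈Δ/2⌉ : {n : ℕ} (G : Graph n) (u : Fin n) →
                degree G u ≤ ⌈ maxDegree G /2⌉ + ⌈ maxDegree G /2⌉
degree≤2⌈Δ/2⌉ G u = ≤-trans (≤-max-over (degree G) u)
  (subst (_≤ c + c) (⌊n/2⌋+⌈n/2⌉≡n (maxDegree G)) (+-monoˡ-≤ c (⌊n/2⌋≤⌈n/2⌉ (maxDegree G))))
  where c = ⌈ maxDegree G /2⌉

forcing-number-bound : ∀ c n k m → k + m ≡ n → n ≤ suc (c * k) → m * c ≤ (c ∸ 1) * n + 1
forcing-number-bound zero    n k m _ _ rewrite *-zeroʳ m = z≤n
forcing-number-bound (suc c) n k m refl n≤ = begin
  m * suc c            ≡⟨ *-suc m c ⟩
  m + m * c            ≤⟨ +-monoˡ-≤ (m * c) m≤ ⟩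
  c * k + 1 + m * c    ≡⟨ regroup₂ ⟩
  c * (k + m) + 1      ∎
  where
  open ≤-Reasoning
  regroup₁ : suc (suc c * k) ≡ k + (c * k + 1)
  regroup₁ = solve 2 (λ c k → con 1 :+ (k :+ c :* k) := k :+ (c :* k :+ con 1)) refl c k
  regroup₂ : c * k + 1 + m * c ≡ c * (k + m) + 1
  regroup₂ = solve 3 (λ c k m → c :* k :+ con 1 :+ m :* c := c :* (k :+ m) :+ con 1) refl c k m
  m≤ : m ≤ c * k + 1
  m≤ = +-cancelˡ-≤ k m (c * k + 1) (subst (k + m ≤_) regroup₁ n≤)

theorem3p9 : ∀ {n : ℕ} (G : Graph n) → TwoEdgeConnected G →
    let c = ⌈ maxDegree G /2⌉ in
    ∃ λ (m : ℕ) → MofAtMost G m × m * c ≤ (c ∸ 1) * n + 1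
theorem3p9 {zero}  G (() , _)
theorem3p9 {suc n} G (_ , connected , _) =
  count starts , (orientation , starts , starts-forcing zero , ≤-refl) ,
  forcing-number-bound c (suc n) (count heads) (count starts) predecessors+starts (begin
    suc n                   ≡⟨ count-nonroot ⟨
    suc (count nonroot)     ≤⟨ s≤s (proj₂ color-choice) ⟩
    suc (c * count member)  ≤⟨ s≤s (*-monoʳ-≤ c member-≤-heads) ⟩
    suc (c * count heads)   ∎)
  where
  open ≤-Reasoning
  c = ⌈ maxDegree G /2⌉
  open ChildLabels (BreadthFirst.tree G zero connected)
  color-choice = pigeonhole c nonroot color (color-< c (degree≤2⌈Δ/2⌉ G))
  open ColorClass (proj₁ color-choice)
  open SuccessorForcing G next (lexKey rank) next⇒edge next-functional (lexKey-injective rank)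
         (λ u v uv → lexKey-monotone rank u v (next-increases-rank u v uv))
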